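{- For any connected graph $G$, every graph search ordering of $G$ is an MNS ordering of $G$ if and only if $G$ is $\{\text{pan}, \text{diamond}\}$-free.
   Context: All graphs are finite and simple. For an ordering $\sigma$ of $V(G)$ write $x<_\sigma y$ if $x$ precedes $y$. A graph search ordering of $G$ is an ordering of $V(G)$ such that every prefix induces a connected subgraph. $\sigma$ is an MNS ordering if whenever $a<_\sigma b<_\sigma c$, $ac\in E(G)$ and $ab\notin E(G)$, there is $d$ with $d<_\sigma b$, $db\in E(G)$ and $dc\notin E(G)$. For $k\ge3$ a $k$-pan is a $k$-cycle plus one extra vertex adjacent to exactly one cycle vertex; pan-free means no induced $k$-pan for any $k\ge3$. The diamond is $K_4$ minus one edge; $\{\text{pan},\text{diamond}\}$-free means no induced pan and no induced diamond. -}

module Defs where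

open import Data.Nat using (ℕ; zero; suc; _≤_; _∸_) renaming (_<_ to _ℕ<_)
open import Data.Unit using (⊤)
open import Data.Fin using (Fin; toℕ; _<_)
open import Data.Fin.Permutation using (Permutation′; _⟨$⟩ˡ_)
open import Data.Product using (Σ; _×_; ∃-syntax)
open import Data.Sum using (_⊎_)
open import Relation.Nullary using (¬_; Dec)
open import Relation.Binary.PropositionalEquality using (_≡_)
open import Function using (_⇔_)
open import Function.Definitions using (Injective)

record Graph : Set₁ where
  field
    n      : ℕ
    E      : Fin n → Fin n → Set
    sym    : ∀ {x y} → E x y → E y x
    irrefl : ∀ {x} → ¬ E x x
    dec    : ∀ x y → Dec (E x y)
open Graph public

data WalkIn (G : Graph) (P : Fin (n G) → Set) : Fin (n G) → Fin (n G) → Set where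
  here : ∀ {x} → P x → WalkIn G P x x
  step : ∀ {x y z} → P x → E G x y → WalkIn G P y z → WalkIn G P x z

InducedConnected : (G : Graph) → (Fin (n G) → Set) → Set
InducedConnected G P = ∀ x y → P x → P y → WalkIn G P x y

Connected : Graph → Set
Connected G = InducedConnected G (λ _ → ⊤)

-- An ordering of V(G): a permutation; σ ⟨$⟩ˡ x is the position of vertex x.
Ordering : Graph → Set
Ordering G = Permutation′ (n G)

_≺[_]_ : {G : Graph} → Fin (n G) → Ordering G → Fin (n G) → Set
x ≺[ σ ] y = (σ ⟨$⟩ˡ x) < (σ ⟨$⟩ˡ y)

GraphSearchOrdering : (G : Graph) → Ordering G → Set
GraphSearchOrdering G σ =
  ∀ (k : ℕ) → InducedConnected G (λ x → toℕ (σ ⟨$⟩ˡ x) ℕ< k)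

MNSOrdering : (G : Graph) → Ordering G → Set
MNSOrdering G σ =
  ∀ a b c → _≺[_]_ {G} a σ b → _≺[_]_ {G} b σ c → E G a c → ¬ E G a b →
  ∃[ d ] (_≺[_]_ {G} d σ b × E G d b × ¬ E G d c)

HasInduced : (G : Graph) (m : ℕ) → (Fin m → Fin m → Set) → Set
HasInduced G m R =
  Σ (Fin m → Fin (n G)) λ f → Injective _≡_ _≡_ f × (∀ i j → E G (f i) (f j) ⇔ R i j)

-- k-pan on Fin (suc k) (k ≥ 3): vertices 0..k-1 form the cycle
-- 0-1-...-(k-1)-0, vertex k is adjacent only to vertex 0.
PanAdjℕ : ℕ → ℕ → ℕ → Set
PanAdjℕ k i j =
    (suc i ≡ j × suc j ≤ k)
  ⊎ (suc j ≡ i × suc i ≤ k)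
  ⊎ (i ≡ 0 × j ≡ k ∸ 1)
  ⊎ (j ≡ 0 × i ≡ k ∸ 1)
  ⊎ (i ≡ k × j ≡ 0)
  ⊎ (j ≡ k × i ≡ 0)

PanAdj : (k : ℕ) → Fin (suc k) → Fin (suc k) → Set
PanAdj k i j = PanAdjℕ k (toℕ i) (toℕ j)

-- Diamond = K4 minus the edge {0,3}.
DiamondAdj : Fin 4 → Fin 4 → Set
DiamondAdj i j = ¬ (toℕ i ≡ toℕ j) × ¬ (toℕ i ≡ 0 × toℕ j ≡ 3) × ¬ (toℕ i ≡ 3 × toℕ j ≡ 0)

PanFree : Graph → Set
PanFree G = ∀ k → 3 ≤ k → ¬ HasInduced G (suc k) (PanAdj k)

DiamondFree : Graph → Set
DiamondFree G = ¬ HasInduced G 4 DiamondAdj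

-- A search ordering violates MNS at a <σ b <σ c (ac ∈ E, ab ∉ E) exactly when every neighbour of b
-- preceding b also sees c. Take an induced path b = v₀, v₁, …, a inside the connected prefix ending
-- at b. Both v₁ and a see c; let v_s (s ≥ 2) be the first later vertex that does. If c sees b, then
-- s = 2 gives the diamond b v₁ c v₂ and s > 2 the triangle b v₁ c with pendant v₂; otherwise
-- c v₁ … v_s is an induced cycle with pendant b.
-- Conversely, a diamond v₀ v₁ v₂ v₃ (v₀v₃ ∉ E) visited as v₀ v₁ v₃ v₂, or a pan with cycle u₀ … u_k
-- and pendant p at u₀ visited as u₀ … u_{k−1} p u_k, is a connected sequence violating MNS, and in a
-- connected graph every connected sequence extends to a search ordering.

module Submission where

open import Defs
open import Data.Nat using (ℕ; zero; suc; _+_; _∸_; _≤_; _<_; z≤n; s≤s; _≟_)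
open import Data.Nat.Properties
open import Data.Nat.Induction using (<-rec)
open import Data.Fin using (Fin; toℕ; fromℕ<; punchOut) renaming (zero to fzero; suc to fsuc)
open import Data.Fin.Patterns using (0F; 1F; 2F; 3F)
open import Data.Fin.Permutation using (Permutation′; permutation; _⟨$⟩ˡ_; _⟨$⟩ʳ_; inverseˡ; inverseʳ)
open import Data.Product using (Σ; ∃-syntax; ∃₂; _×_; _,_; proj₁; proj₂; uncurry)
open import Data.Sum using (_⊎_; inj₁; inj₂; [_,_]′)
open import Data.Empty using (⊥-elim)
open import Relation.Nullary using (¬_; Dec; yes; no; contradiction)
open import Relation.Nullary.Decidable using (_⊎-dec_; _×-dec_; ¬?; True; toWitness; toWitnessFalse; decidable-stable)
open import Relation.Unary using (Decidable)
open import Relation.Binary.Definitions using (tri<; tri≈; tri>)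
open import Relation.Binary.PropositionalEquality
  using (_≡_; _≢_; ≢-sym; refl; cong; subst; subst₂; module ≡-Reasoning) renaming (sym to ≡-sym; trans to ≡-trans)
open import Function using (_⇔_; mk⇔; Equivalence; _∘_)
open import Function.Definitions using (Injective)
open import Function.Properties.Equivalence using () renaming (sym to ⇔-sym; trans to ⇔-trans)
import Data.Fin.Properties as Fin

module _ {P : ℕ → Set} (P? : Decidable P) where

  least : ∀ {k} → P k → ∃[ m ] m ≤ k × P m × (∀ {i} → i < m → ¬ P i)
  least = below _ ≤-refl
    where
    below : ∀ b {k} → k ≤ b → P k → ∃[ m ] m ≤ k × P m × (∀ {i} → i < m → ¬ P i)
    below zero z≤n p₀ = 0 , z≤n , p₀ , λ ()
    below (suc b) {k} k≤b pk with anyUpTo? P? k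
    ... | no none = k , ≤-refl , pk , λ i<k pi → none (_ , i<k , pi)
    ... | yes (i , i<k , pi) =
      let m , m≤i , pm , minimal = below b (≤-pred (≤-trans i<k k≤b)) pi
      in m , ≤-trans m≤i (<⇒≤ i<k) , pm , minimal

  greatest : ∀ k → P 0 → ∃[ m ] m ≤ k × P m × (∀ {i} → m < i → i ≤ k → ¬ P i)
  greatest zero p₀ = 0 , z≤n , p₀ , λ 0<i i≤0 → ⊥-elim (<⇒≱ 0<i i≤0)
  greatest (suc k) p₀ with P? (suc k) | greatest k p₀
  ... | yes pk | _ = suc k , ≤-refl , pk , λ k<i i≤k → ⊥-elim (<⇒≱ k<i i≤k)
  ... | no ¬pk | m , m≤k , pm , maximal = m , m≤n⇒m≤1+n m≤k , pm , beyond
    where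
    beyond : ∀ {i} → m < i → i ≤ suc k → ¬ P i
    beyond m<i i≤ with m≤n⇒m<n∨m≡n i≤
    ... | inj₁ i<k = maximal m<i (≤-pred i<k)
    ... | inj₂ refl = ¬pk

swapSuc : ℕ → ℕ → ℕ
swapSuc zero zero = 1
swapSuc zero (suc zero) = 0
swapSuc zero j@(suc (suc _)) = j
swapSuc (suc k) zero = zero
swapSuc (suc k) (suc j) = suc (swapSuc k j)

swapSuc-< : ∀ {k j} → j < k → swapSuc k j ≡ j
swapSuc-< {suc k} {zero} _ = refl
swapSuc-< {suc k} {suc j} (s≤s j<k) = cong suc (swapSuc-< j<k)

swapSuc-self : ∀ k → swapSuc k k ≡ suc k
swapSuc-self zero = refl
swapSuc-self (suc k) = cong suc (swapSuc-self k)

swapSuc-suc : ∀ k → swapSuc k (suc k) ≡ k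
swapSuc-suc zero = refl
swapSuc-suc (suc k) = cong suc (swapSuc-suc k)

swapSuc-involutive : ∀ k j → swapSuc k (swapSuc k j) ≡ j
swapSuc-involutive zero zero = refl
swapSuc-involutive zero (suc zero) = refl
swapSuc-involutive zero (suc (suc j)) = refl
swapSuc-involutive (suc k) zero = refl
swapSuc-involutive (suc k) (suc j) = cong suc (swapSuc-involutive k j)

swapSuc-≤ : ∀ {k j} → j ≤ suc k → swapSuc k j ≤ suc k
swapSuc-≤ {zero} {zero} _ = s≤s z≤n
swapSuc-≤ {zero} {suc zero} _ = z≤n
swapSuc-≤ {zero} {suc (suc j)} (s≤s ())
swapSuc-≤ {suc k} {zero} _ = z≤n
swapSuc-≤ {suc k} {suc j} (s≤s j≤) = s≤s (swapSuc-≤ j≤)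

clamp : ∀ k → ℕ → Fin (suc k)
clamp k zero = fzero
clamp zero (suc j) = fzero
clamp (suc k) (suc j) = fsuc (clamp k j)

toℕ-clamp : ∀ {k j} → j ≤ k → toℕ (clamp k j) ≡ j
toℕ-clamp {k} {zero} _ = refl
toℕ-clamp {suc k} {suc j} (s≤s j≤k) = cong suc (toℕ-clamp j≤k)

injective⇒surjective : ∀ {m} (f : Fin m → Fin m) → Injective _≡_ _≡_ f → ∀ y → ∃[ x ] f x ≡ y
injective⇒surjective {suc m} f f-injective y with Fin.any? (λ x → f x Fin.≟ y)
... | yes found = found
... | no ¬found = contradiction (Fin.injective⇒≤ punched-injective) 1+n≰n
  where
  punched : Fin (suc m) → Fin m
  punched x = punchOut (λ y≡fx → ¬found (x , ≡-sym y≡fx))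
  punched-injective : Injective _≡_ _≡_ punched
  punched-injective eq = f-injective (Fin.punchOut-injective {i = y} _ _ eq)

injective⇒permutation : ∀ {m} (f : Fin m → Fin m) → Injective _≡_ _≡_ f → Permutation′ m
injective⇒permutation f f-injective =
  permutation f (proj₁ ∘ preimage) (proj₂ ∘ preimage) (λ x → f-injective (proj₂ (preimage (f x))))
  where preimage = injective⇒surjective f f-injective

missedValue : ∀ {p q} (f : Fin p → Fin q) → p < q → ∃[ y ] ¬ (∃[ x ] f x ≡ y)
missedValue {p} {q} f p<q = Fin.¬∀⟶∃¬ q _ (λ y → Fin.any? λ x → f x Fin.≟ y) λ onto →
  <⇒≱ p<q (Fin.injective⇒≤ {f = proj₁ ∘ onto} λ {y} {y′} eq →
    ≡-trans (≡-sym (proj₂ (onto y))) (≡-trans (cong f eq) (proj₂ (onto y′))))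

panAdj-sym : ∀ {k i j} → PanAdjℕ k i j → PanAdjℕ k j i
panAdj-sym (inj₁ e) = inj₂ (inj₁ e)
panAdj-sym (inj₂ (inj₁ e)) = inj₁ e
panAdj-sym (inj₂ (inj₂ (inj₁ e))) = inj₂ (inj₂ (inj₂ (inj₁ e)))
panAdj-sym (inj₂ (inj₂ (inj₂ (inj₁ e)))) = inj₂ (inj₂ (inj₁ e))
panAdj-sym (inj₂ (inj₂ (inj₂ (inj₂ (inj₁ e))))) = inj₂ (inj₂ (inj₂ (inj₂ (inj₂ e))))
panAdj-sym (inj₂ (inj₂ (inj₂ (inj₂ (inj₂ e))))) = inj₂ (inj₂ (inj₂ (inj₂ (inj₁ e))))

module _ {m : ℕ} where

  panAdj-irrefl : ∀ {i} → ¬ PanAdjℕ (2 + m) i i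
  panAdj-irrefl (inj₁ (() , _))
  panAdj-irrefl (inj₂ (inj₁ (() , _)))
  panAdj-irrefl (inj₂ (inj₂ (inj₁ (refl , ()))))
  panAdj-irrefl (inj₂ (inj₂ (inj₂ (inj₁ (refl , ())))))
  panAdj-irrefl (inj₂ (inj₂ (inj₂ (inj₂ (inj₁ (refl , ()))))))
  panAdj-irrefl (inj₂ (inj₂ (inj₂ (inj₂ (inj₂ (refl , ()))))))

  private
    ≤⇒≢1+ : ∀ {i} → i ≤ m → i ≢ suc m
    ≤⇒≢1+ i≤m = <⇒≢ (s≤s i≤m)

    ≤⇒≢2+ : ∀ {i} → i ≤ m → i ≢ 2 + m
    ≤⇒≢2+ i≤m = <⇒≢ (s≤s (m≤n⇒m≤1+n i≤m))

  panAdj-cycle : ∀ {i j} → i ≤ m → j ≤ m → PanAdjℕ (2 + m) i j ⇔ (suc i ≡ j ⊎ suc j ≡ i)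
  panAdj-cycle {i} {j} i≤m j≤m = mk⇔ to from
    where
    to : PanAdjℕ (2 + m) i j → suc i ≡ j ⊎ suc j ≡ i
    to (inj₁ (e , _)) = inj₁ e
    to (inj₂ (inj₁ (e , _))) = inj₂ e
    to (inj₂ (inj₂ (inj₁ (_ , j≡)))) = contradiction j≡ (≤⇒≢1+ j≤m)
    to (inj₂ (inj₂ (inj₂ (inj₁ (_ , i≡))))) = contradiction i≡ (≤⇒≢1+ i≤m)
    to (inj₂ (inj₂ (inj₂ (inj₂ (inj₁ (i≡ , _)))))) = contradiction i≡ (≤⇒≢2+ i≤m)
    to (inj₂ (inj₂ (inj₂ (inj₂ (inj₂ (j≡ , _)))))) = contradiction j≡ (≤⇒≢2+ j≤m)
    from : suc i ≡ j ⊎ suc j ≡ i → PanAdjℕ (2 + m) i j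
    from (inj₁ e) = inj₁ (e , s≤s (m≤n⇒m≤1+n j≤m))
    from (inj₂ e) = inj₂ (inj₁ (e , s≤s (m≤n⇒m≤1+n i≤m)))

  panAdj-closing : ∀ {i} → i ≤ m → PanAdjℕ (2 + m) i (suc m) ⇔ (i ≡ 0 ⊎ i ≡ m)
  panAdj-closing {i} i≤m = mk⇔ to from
    where
    to : PanAdjℕ (2 + m) i (suc m) → i ≡ 0 ⊎ i ≡ m
    to (inj₁ (refl , _)) = inj₂ refl
    to (inj₂ (inj₁ (i≡ , _))) = contradiction (≡-sym i≡) (≤⇒≢2+ i≤m)
    to (inj₂ (inj₂ (inj₁ (i≡0 , _)))) = inj₁ i≡0
    to (inj₂ (inj₂ (inj₂ (inj₁ (() , _)))))
    to (inj₂ (inj₂ (inj₂ (inj₂ (inj₁ (i≡ , _)))))) = contradiction i≡ (≤⇒≢2+ i≤m)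
    to (inj₂ (inj₂ (inj₂ (inj₂ (inj₂ (() , _))))))
    from : i ≡ 0 ⊎ i ≡ m → PanAdjℕ (2 + m) i (suc m)
    from (inj₁ refl) = inj₂ (inj₂ (inj₁ (refl , refl)))
    from (inj₂ refl) = inj₁ (refl , ≤-refl)

  panAdj-pendant : ∀ {i} → i ≤ m → PanAdjℕ (2 + m) i (2 + m) ⇔ i ≡ 0
  panAdj-pendant {i} i≤m = mk⇔ to from
    where
    to : PanAdjℕ (2 + m) i (2 + m) → i ≡ 0
    to (inj₁ (_ , 3+m≤2+m)) = contradiction 3+m≤2+m 1+n≰n
    to (inj₂ (inj₁ (i≡ , _))) = contradiction (≡-sym i≡) (<⇒≢ (s≤s (m≤n⇒m≤1+n (m≤n⇒m≤1+n i≤m))))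
    to (inj₂ (inj₂ (inj₁ (i≡0 , _)))) = i≡0
    to (inj₂ (inj₂ (inj₂ (inj₁ (() , _)))))
    to (inj₂ (inj₂ (inj₂ (inj₂ (inj₁ (i≡ , _)))))) = contradiction i≡ (≤⇒≢2+ i≤m)
    to (inj₂ (inj₂ (inj₂ (inj₂ (inj₂ (_ , i≡0)))))) = i≡0
    from : i ≡ 0 → PanAdjℕ (2 + m) i (2 + m)
    from refl = inj₂ (inj₂ (inj₂ (inj₂ (inj₂ (refl , refl)))))

  ¬panAdj-closing-pendant : ¬ PanAdjℕ (2 + m) (suc m) (2 + m)
  ¬panAdj-closing-pendant (inj₁ (_ , 3+m≤2+m)) = 1+n≰n 3+m≤2+m
  ¬panAdj-closing-pendant (inj₂ (inj₁ (() , _)))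
  ¬panAdj-closing-pendant (inj₂ (inj₂ (inj₁ (() , _))))
  ¬panAdj-closing-pendant (inj₂ (inj₂ (inj₂ (inj₁ (() , _)))))
  ¬panAdj-closing-pendant (inj₂ (inj₂ (inj₂ (inj₂ (inj₁ (() , _))))))
  ¬panAdj-closing-pendant (inj₂ (inj₂ (inj₂ (inj₂ (inj₂ (_ , ()))))))

DiamondAdjℕ : ℕ → ℕ → Set
DiamondAdjℕ a b = ¬ (a ≡ b) × ¬ (a ≡ 0 × b ≡ 3) × ¬ (a ≡ 3 × b ≡ 0)

diamondAdj? : ∀ a b → Dec (DiamondAdjℕ a b)
diamondAdj? a b = ¬? (a ≟ b) ×-dec ¬? (a ≟ 0 ×-dec b ≟ 3) ×-dec ¬? (a ≟ 3 ×-dec b ≟ 0)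

data PanPosition (m : ℕ) : ℕ → Set where
  onPath  : ∀ {i} → i ≤ m → PanPosition m i
  closing : PanPosition m (suc m)
  pendant : PanPosition m (2 + m)

panPosition : ∀ {m i} → i ≤ 2 + m → PanPosition m i
panPosition i≤ with m≤n⇒m<n∨m≡n i≤
... | inj₂ refl = pendant
... | inj₁ (s≤s i≤1+m) with m≤n⇒m<n∨m≡n i≤1+m
...   | inj₂ refl = closing
...   | inj₁ (s≤s i≤m) = onPath i≤m

NonMNSSearchOrdering : Graph → Set
NonMNSSearchOrdering G = Σ (Ordering G) λ σ → GraphSearchOrdering G σ × ¬ MNSOrdering G σ

HasPan : Graph → Set
HasPan G = ∃[ k ] 3 ≤ k × HasInduced G (suc k) (PanAdj k)

-- Only the vertices 0 … len are part of the path.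
record InducedPath (G : Graph) : Set where
  field
    len       : ℕ
    vertex    : ℕ → Fin (n G)
    adjacent  : ∀ {i} → i < len → E G (vertex i) (vertex (suc i))
    chordless : ∀ {i j} → suc i < j → j ≤ len → ¬ E G (vertex i) (vertex j)
    distinct  : ∀ {i j} → i < j → j ≤ len → vertex i ≢ vertex j

open InducedPath

module _ {G : Graph} where

  module _ {P : Fin (n G) → Set} where

    walk-++ : ∀ {x y z} → WalkIn G P x y → WalkIn G P y z → WalkIn G P x z
    walk-++ (here _) w = w
    walk-++ (step px e w) w′ = step px e (walk-++ w w′)

    walk-start : ∀ {x y} → WalkIn G P x y → P x
    walk-start (here px) = px
    walk-start (step px _ _) = px

    walk-reverse : ∀ {x y} → WalkIn G P x y → WalkIn G P y x
    walk-reverse (here px) = here px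
    walk-reverse (step px e w) = walk-++ (walk-reverse w) (step (walk-start w) (sym G e) (here px))

    crossingEdge : ∀ {S : Fin (n G) → Set} → Decidable S → ∀ {x y} → WalkIn G P x y → S x → ¬ S y →
                   ∃₂ λ u v → S u × ¬ S v × E G u v
    crossingEdge S? (here _) sx ¬sy = contradiction sx ¬sy
    crossingEdge S? {x} (step {y = x′} _ e w) sx ¬sy with S? x′
    ... | yes sx′ = crossingEdge S? w sx′ ¬sy
    ... | no ¬sx′ = x , x′ , sx , ¬sx′ , e

  adjacent⇒≢ : ∀ {x y} → E G x y → x ≢ y
  adjacent⇒≢ e refl = irrefl G e

  singleton : Fin (n G) → InducedPath G
  singleton x = record
    { len = 0 ; vertex = λ _ → x ; adjacent = λ () ; chordless = λ { () z≤n } ; distinct = λ { () z≤n } }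

  cons : (x : Fin (n G)) (p : InducedPath G) → E G x (vertex p 0) →
         (∀ {j} → j ≤ len p → x ≢ vertex p j) →
         (∀ {j} → 0 < j → j ≤ len p → ¬ E G x (vertex p j)) → InducedPath G
  cons x p x~p₀ fresh far = record
    { len = suc (len p) ; vertex = vertex′ ; adjacent = adj ; chordless = chl ; distinct = dst }
    where
    vertex′ : ℕ → Fin (n G)
    vertex′ zero = x
    vertex′ (suc j) = vertex p j
    adj : ∀ {i} → i < suc (len p) → E G (vertex′ i) (vertex′ (suc i))
    adj {zero} _ = x~p₀
    adj {suc i} (s≤s i<) = adjacent p i<
    chl : ∀ {i j} → suc i < j → j ≤ suc (len p) → ¬ E G (vertex′ i) (vertex′ j)
    chl {zero} {suc j} (s≤s 0<j) (s≤s j≤) = far 0<j j≤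
    chl {suc i} {suc j} (s≤s i<j) (s≤s j≤) = chordless p i<j j≤
    dst : ∀ {i j} → i < j → j ≤ suc (len p) → vertex′ i ≢ vertex′ j
    dst {zero} {suc j} _ (s≤s j≤) = fresh j≤
    dst {suc i} {suc j} (s≤s i<j) (s≤s j≤) = distinct p i<j j≤

  edge : ∀ {x y} → E G x y → InducedPath G
  edge {x} {y} x~y = cons x (singleton y) x~y (λ _ → adjacent⇒≢ x~y) (λ { 0<j z≤n → contradiction 0<j λ () })

  take : (k : ℕ) (p : InducedPath G) → k ≤ len p → InducedPath G
  take k p k≤ = record
    { len = k ; vertex = vertex p
    ; adjacent = λ i<k → adjacent p (<-≤-trans i<k k≤)
    ; chordless = λ i<j j≤k → chordless p i<j (≤-trans j≤k k≤)
    ; distinct = λ i<j j≤k → distinct p i<j (≤-trans j≤k k≤) }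

  module _ (k : ℕ) (p : InducedPath G) (k≤ : k ≤ len p) where

    drop-within : ∀ {j} → j ≤ len p ∸ k → k + j ≤ len p
    drop-within j≤ = ≤-trans (+-monoʳ-≤ k j≤) (≤-reflexive (m+[n∸m]≡n k≤))

    drop : InducedPath G
    drop = record
      { len = len p ∸ k ; vertex = λ i → vertex p (k + i)
      ; adjacent = λ {i} i< → subst (λ t → E G (vertex p (k + i)) (vertex p t)) (≡-sym (+-suc k i))
                                    (adjacent p (subst (_≤ len p) (+-suc k i) (drop-within i<)))
      ; chordless = λ {i} {j} i<j j≤ → chordless p (subst (_< k + j) (+-suc k i) (+-monoʳ-< k i<j)) (drop-within j≤)
      ; distinct = λ i<j j≤ → distinct p (+-monoʳ-< k i<j) (drop-within j≤) }

    drop-start : vertex drop 0 ≡ vertex p k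
    drop-start = cong (vertex p) (+-identityʳ k)

    drop-end : vertex drop (len drop) ≡ vertex p (len p)
    drop-end = cong (vertex p) (m+[n∸m]≡n k≤)

  adjacent⇔consecutive : (p : InducedPath G) → ∀ {i j} → i ≤ len p → j ≤ len p →
                         E G (vertex p i) (vertex p j) ⇔ (suc i ≡ j ⊎ suc j ≡ i)
  adjacent⇔consecutive p {i} {j} i≤ j≤ = mk⇔ to from
    where
    to : E G (vertex p i) (vertex p j) → suc i ≡ j ⊎ suc j ≡ i
    to e with <-cmp i j
    ... | tri≈ _ refl _ = contradiction e (irrefl G)
    ... | tri< i<j _ _ with m≤n⇒m<n∨m≡n i<j
    ...   | inj₁ si<j = contradiction e (chordless p si<j j≤)
    ...   | inj₂ si≡j = inj₁ si≡j
    to e | tri> _ _ j<i with m≤n⇒m<n∨m≡n j<i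
    ...   | inj₁ sj<i = contradiction (sym G e) (chordless p sj<i i≤)
    ...   | inj₂ sj≡i = inj₂ sj≡i
    from : suc i ≡ j ⊎ suc j ≡ i → E G (vertex p i) (vertex p j)
    from (inj₁ refl) = adjacent p j≤
    from (inj₂ refl) = sym G (adjacent p i≤)

  Joins : InducedPath G → Fin (n G) → Fin (n G) → Set
  Joins p x y = vertex p 0 ≡ x × vertex p (len p) ≡ y

  Within : (Fin (n G) → Set) → InducedPath G → Set
  Within P p = ∀ {i} → i ≤ len p → P (vertex p i)

  nonadjacentEnds⇒2≤len : ∀ {p x y} → Joins p x y → x ≢ y → ¬ E G x y → 2 ≤ len p
  nonadjacentEnds⇒2≤len {p} (p₀ , p-end) x≢y ¬x~y with len p in eq
  ... | zero = contradiction (≡-trans (≡-sym p₀) p-end) x≢y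
  ... | suc zero = contradiction (subst₂ (E G) p₀ p-end (adjacent p (≤-reflexive (≡-sym eq)))) ¬x~y
  ... | suc (suc _) = s≤s (s≤s z≤n)

  -- x is joined directly to the last vertex of the rest's induced path that equals or sees x.
  walk⇒inducedPath : ∀ {P x y} → WalkIn G P x y → Σ (InducedPath G) λ p → Joins p x y × Within P p
  walk⇒inducedPath (here px) = singleton _ , (refl , refl) , λ _ → px
  walk⇒inducedPath {P} {x} {y} (step px x~x′ w) with walk⇒inducedPath w
  ... | q , (q₀ , q-end) , q-in
    with greatest (λ i → vertex q i Fin.≟ x ⊎-dec dec G x (vertex q i)) (len q)
                  (inj₂ (subst (E G x) (≡-sym q₀) x~x′))
  ... | k , k≤ , qk , later = shortcut qk
    where
    rest = drop k q k≤
    rest-end : vertex rest (len rest) ≡ y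
    rest-end = ≡-trans (drop-end k q k≤) q-end
    rest-in : Within P rest
    rest-in j≤ = q-in (drop-within k q k≤ j≤)
    unseen : ∀ {j} → 0 < j → j ≤ len rest → ¬ (vertex rest j ≡ x ⊎ E G x (vertex rest j))
    unseen 0<j j≤ = later (m<m+n k 0<j) (drop-within k q k≤ j≤)
    shortcut : vertex q k ≡ x ⊎ E G x (vertex q k) → Σ (InducedPath G) λ p → Joins p x y × Within P p
    shortcut (inj₁ qk≡x) = rest , (≡-trans (drop-start k q k≤) qk≡x , rest-end) , rest-in
    shortcut (inj₂ x~qk) = path , (refl , rest-end) , inside
      where
      x~rest₀ : E G x (vertex rest 0)
      x~rest₀ = subst (E G x) (≡-sym (drop-start k q k≤)) x~qk
      fresh : ∀ {j} → j ≤ len rest → x ≢ vertex rest j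
      fresh {zero} _ = adjacent⇒≢ x~rest₀
      fresh {suc j} j≤ x≡ = unseen (s≤s z≤n) j≤ (inj₁ (≡-sym x≡))
      path : InducedPath G
      path = cons x rest x~rest₀ fresh (λ 0<j j≤ → unseen 0<j j≤ ∘ inj₂)
      inside : Within P path
      inside {zero} _ = px
      inside {suc i} (s≤s i≤) = rest-in i≤

  -- Induced pans and diamonds

  inducedFromPairs : ∀ {m} {R : Fin m → Fin m → Set} (f : Fin m → Fin (n G)) →
                     (∀ {i j} → R i j → R j i) → (∀ {i} → ¬ R i i) →
                     (∀ {i j} → toℕ i < toℕ j → f i ≢ f j × (E G (f i) (f j) ⇔ R i j)) →
                     HasInduced G m R
  inducedFromPairs {R = R} f R-sym R-irrefl pair = f , injective , adjacency
    where
    injective : Injective _≡_ _≡_ f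
    injective {i} {j} fi≡fj with Fin.<-cmp i j
    ... | tri< i<j _ _ = contradiction fi≡fj (proj₁ (pair i<j))
    ... | tri≈ _ i≡j _ = i≡j
    ... | tri> _ _ j<i = contradiction (≡-sym fi≡fj) (proj₁ (pair j<i))
    adjacency : ∀ i j → E G (f i) (f j) ⇔ R i j
    adjacency i j with Fin.<-cmp i j
    ... | tri< i<j _ _ = proj₂ (pair i<j)
    ... | tri≈ _ refl _ = mk⇔ (λ e → contradiction e (irrefl G)) (λ r → contradiction r R-irrefl)
    ... | tri> _ _ j<i = mk⇔ (R-sym ∘ to ∘ sym G) (sym G ∘ from ∘ R-sym)
      where open Equivalence (proj₂ (pair j<i))

  inducedDiamond : ∀ {v₀ v₁ v₂ v₃} → E G v₀ v₁ → E G v₀ v₂ → E G v₁ v₂ → E G v₁ v₃ → E G v₂ v₃ →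
                   ¬ E G v₀ v₃ → v₀ ≢ v₃ → HasInduced G 4 DiamondAdj
  inducedDiamond {v₀} {v₁} {v₂} {v₃} e₀₁ e₀₂ e₁₂ e₁₃ e₂₃ ¬e₀₃ v₀≢v₃ =
    inducedFromPairs vertexAt diamond-sym (λ d → proj₁ d refl) pair
    where
    vertexAt : Fin 4 → Fin (n G)
    vertexAt 0F = v₀
    vertexAt 1F = v₁
    vertexAt 2F = v₂
    vertexAt 3F = v₃
    diamond-sym : ∀ {i j} → DiamondAdj i j → DiamondAdj j i
    diamond-sym (i≢j , ¬03 , ¬30) = i≢j ∘ ≡-sym , (λ (a , b) → ¬30 (b , a)) , (λ (a , b) → ¬03 (b , a))
    PairFact : Fin 4 → Fin 4 → Set
    PairFact i j = vertexAt i ≢ vertexAt j × (E G (vertexAt i) (vertexAt j) ⇔ DiamondAdj i j)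
    edgePair : ∀ {i j} → E G (vertexAt i) (vertexAt j) → {True (diamondAdj? (toℕ i) (toℕ j))} → PairFact i j
    edgePair e {d} = adjacent⇒≢ e , mk⇔ (λ _ → toWitness d) (λ _ → e)
    pair : ∀ {i j} → toℕ i < toℕ j → PairFact i j
    pair {0F} {1F} _ = edgePair e₀₁
    pair {0F} {2F} _ = edgePair e₀₂
    pair {0F} {3F} _ = v₀≢v₃ , mk⇔ (λ e → contradiction e ¬e₀₃) (λ d → contradiction (refl , refl) (proj₁ (proj₂ d)))
    pair {1F} {2F} _ = edgePair e₁₂
    pair {1F} {3F} _ = edgePair e₁₃
    pair {2F} {3F} _ = edgePair e₂₃
    pair {0F} {0F} ()
    pair {1F} {0F} ()
    pair {1F} {1F} (s≤s ())
    pair {2F} {0F} ()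
    pair {2F} {1F} (s≤s ())
    pair {2F} {2F} (s≤s (s≤s ()))
    pair {3F} {0F} ()
    pair {3F} {1F} (s≤s ())
    pair {3F} {2F} (s≤s (s≤s ()))
    pair {3F} {3F} (s≤s (s≤s (s≤s ())))

  inducedPan : (y : InducedPath G) (c p : Fin (n G)) →
               (∀ {i} → i ≤ len y → E G (vertex y i) c ⇔ (i ≡ 0 ⊎ i ≡ len y)) →
               (∀ {i} → i ≤ len y → E G (vertex y i) p ⇔ i ≡ 0) → ¬ E G c p →
               (∀ {i} → i ≤ len y → c ≢ vertex y i) → (∀ {i} → i ≤ len y → p ≢ vertex y i) → c ≢ p →
               HasInduced G (3 + len y) (PanAdj (2 + len y))
  inducedPan y c p y~c y~p ¬c~p c∉y p∉y c≢p =
    inducedFromPairs (λ i → place (panPosition (Fin.toℕ≤pred[n] i))) panAdj-sym panAdj-irrefl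
                     (λ {i} {j} → placed (panPosition (Fin.toℕ≤pred[n] i)) (panPosition (Fin.toℕ≤pred[n] j)))
    where
    m = len y
    place : ∀ {i} → PanPosition m i → Fin (n G)
    place (onPath {i} _) = vertex y i
    place closing = c
    place pendant = p
    placed : ∀ {i j} (x : PanPosition m i) (z : PanPosition m j) → i < j →
             place x ≢ place z × (E G (place x) (place z) ⇔ PanAdjℕ (2 + m) i j)
    placed (onPath i≤) (onPath j≤) i<j =
      distinct y i<j j≤ , ⇔-trans (adjacent⇔consecutive y i≤ j≤) (⇔-sym (panAdj-cycle i≤ j≤))
    placed (onPath i≤) closing _ = ≢-sym (c∉y i≤) , ⇔-trans (y~c i≤) (⇔-sym (panAdj-closing i≤))
    placed (onPath i≤) pendant _ = ≢-sym (p∉y i≤) , ⇔-trans (y~p i≤) (⇔-sym (panAdj-pendant i≤))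
    placed closing pendant _ =
      c≢p , mk⇔ (λ e → contradiction e ¬c~p) (λ a → contradiction a ¬panAdj-closing-pendant)
    placed closing (onPath j≤) m<j = contradiction (m≤n⇒m≤1+n j≤) (<⇒≱ m<j)
    placed closing closing m<m = contradiction m<m (<-irrefl refl)
    placed pendant (onPath j≤) m<j = contradiction (m≤n⇒m≤1+n (m≤n⇒m≤1+n j≤)) (<⇒≱ m<j)
    placed pendant closing m<m = contradiction (n≤1+n _) (<⇒≱ m<m)
    placed pendant pendant m<m = contradiction m<m (<-irrefl refl)

  module _ (p : InducedPath G) (c : Fin (n G)) (c∉p : ∀ {i} → i ≤ len p → c ≢ vertex p i)
           (c~v₁ : E G c (vertex p 1)) (2≤len : 2 ≤ len p) where

    private
      v = vertex p
      0<len = <-trans (s≤s z≤n) 2≤len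
      1<len = 2≤len

    diamondAtStart : E G c (v 0) → E G c (v 2) → HasInduced G 4 DiamondAdj
    diamondAtStart c~v₀ c~v₂ =
      inducedDiamond (adjacent p 0<len) (sym G c~v₀) (sym G c~v₁) (adjacent p 1<len) c~v₂
                     (chordless p ≤-refl 2≤len) (distinct p (s≤s z≤n) 2≤len)

    triangleWithPendant : E G c (v 0) → ¬ E G c (v 2) → HasPan G
    triangleWithPendant c~v₀ ¬c~v₂ = 3 , ≤-refl ,
      inducedPan y c (v 2) y~c y~v₂ ¬c~v₂ c∉y v₂∉y (c∉p 2≤len)
      where
      y = edge (sym G (adjacent p 0<len))
      c∉y : ∀ {i} → i ≤ 1 → c ≢ vertex y i
      c∉y {zero} _ = c∉p (<⇒≤ 1<len)
      c∉y {suc zero} _ = c∉p z≤n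
      c∉y {suc (suc _)} (s≤s ())
      y~c : ∀ {i} → i ≤ 1 → E G (vertex y i) c ⇔ (i ≡ 0 ⊎ i ≡ 1)
      y~c {zero} _ = mk⇔ (λ _ → inj₁ refl) (λ _ → sym G c~v₁)
      y~c {suc zero} _ = mk⇔ (λ _ → inj₂ refl) (λ _ → sym G c~v₀)
      y~c {suc (suc _)} (s≤s ())
      y~v₂ : ∀ {i} → i ≤ 1 → E G (vertex y i) (v 2) ⇔ i ≡ 0
      y~v₂ {zero} _ = mk⇔ (λ _ → refl) (λ _ → adjacent p 1<len)
      y~v₂ {suc zero} _ = mk⇔ (λ e → contradiction e (chordless p ≤-refl 2≤len)) (λ ())
      y~v₂ {suc (suc _)} (s≤s ())
      v₂∉y : ∀ {i} → i ≤ 1 → v 2 ≢ vertex y i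
      v₂∉y {zero} _ = ≢-sym (distinct p ≤-refl 2≤len)
      v₂∉y {suc zero} _ = ≢-sym (distinct p (s≤s z≤n) 2≤len)
      v₂∉y {suc (suc _)} (s≤s ())

    cycleWithPendant : ∀ {s} → 2 + s ≤ len p → ¬ E G c (v 0) → E G c (v (2 + s)) →
                       (∀ {i} → i < s → ¬ E G c (v (2 + i))) → HasPan G
    cycleWithPendant {s} 2+s≤len ¬c~v₀ c~v₂₊ₛ c≁between = 3 + s , s≤s (s≤s (s≤s z≤n)) ,
      inducedPan y c (v 0) y~c y~v₀ ¬c~v₀ (λ i≤ → c∉p (inside i≤)) v₀∉y (c∉p z≤n)
      where
      y = drop 1 (take (2 + s) p 2+s≤len) (s≤s z≤n)
      inside : ∀ {i} → i ≤ suc s → suc i ≤ len p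
      inside i≤ = ≤-trans (s≤s i≤) 2+s≤len
      y~c : ∀ {i} → i ≤ suc s → E G (v (suc i)) c ⇔ (i ≡ 0 ⊎ i ≡ suc s)
      y~c {zero} _ = mk⇔ (λ _ → inj₁ refl) (λ _ → sym G c~v₁)
      y~c {suc i} (s≤s i≤s) with m≤n⇒m<n∨m≡n i≤s
      ... | inj₁ i<s = mk⇔ (λ e → contradiction (sym G e) (c≁between i<s))
                           (λ { (inj₁ ()) ; (inj₂ refl) → contradiction i<s (<-irrefl refl) })
      ... | inj₂ refl = mk⇔ (λ _ → inj₂ refl) (λ _ → sym G c~v₂₊ₛ)
      y~v₀ : ∀ {i} → i ≤ suc s → E G (v (suc i)) (v 0) ⇔ i ≡ 0
      y~v₀ {zero} _ = mk⇔ (λ _ → refl) (λ _ → sym G (adjacent p 0<len))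
      y~v₀ {suc i} i≤ = mk⇔ (λ e → contradiction (sym G e) (chordless p (s≤s (s≤s z≤n)) (inside i≤))) (λ ())
      v₀∉y : ∀ {i} → i ≤ suc s → v 0 ≢ v (suc i)
      v₀∉y i≤ = distinct p (s≤s z≤n) (inside i≤)

  inducedPanOrDiamond : (p : InducedPath G) → 2 ≤ len p → (c : Fin (n G)) →
                        (∀ {i} → i ≤ len p → c ≢ vertex p i) →
                        E G c (vertex p 1) → E G c (vertex p (len p)) → HasPan G ⊎ HasInduced G 4 DiamondAdj
  inducedPanOrDiamond p 2≤len c c∉p c~v₁ c~end
    with least (λ s → dec G c (vertex p (2 + s))) (subst (E G c ∘ vertex p) (≡-sym (m+[n∸m]≡n 2≤len)) c~end)
  ... | s , s≤ , c~v₂₊ₛ , c≁between with dec G c (vertex p 0) | s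
  ...   | no ¬c~v₀ | _ = inj₁ (cycleWithPendant p c c∉p c~v₁ 2≤len 2+s≤len ¬c~v₀ c~v₂₊ₛ c≁between)
    where 2+s≤len = ≤-trans (+-monoʳ-≤ 2 s≤) (≤-reflexive (m+[n∸m]≡n 2≤len))
  ...   | yes c~v₀ | zero = inj₂ (diamondAtStart p c c∉p c~v₁ 2≤len c~v₀ c~v₂₊ₛ)
  ...   | yes c~v₀ | suc _ = inj₁ (triangleWithPendant p c c∉p c~v₁ 2≤len c~v₀ (c≁between (s≤s z≤n)))

  -- Search orderings of pan- and diamond-free graphs are MNS orderings

  position : Ordering G → Fin (n G) → ℕ
  position σ x = toℕ (σ ⟨$⟩ˡ x)

  position-injective : ∀ σ {x y} → position σ x ≡ position σ y → x ≡ y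
  position-injective σ {x} {y} eq = begin
    x                       ≡⟨ inverseʳ σ ⟨
    σ ⟨$⟩ʳ (σ ⟨$⟩ˡ x)       ≡⟨ cong (σ ⟨$⟩ʳ_) (Fin.toℕ-injective eq) ⟩
    σ ⟨$⟩ʳ (σ ⟨$⟩ˡ y)       ≡⟨ inverseʳ σ ⟩
    y                       ∎
    where open ≡-Reasoning

  unresolved⇒panOrDiamond : ∀ σ → GraphSearchOrdering G σ → ∀ {a b c} →
    position σ a < position σ b → position σ b < position σ c → E G a c → ¬ E G a b →
    (∀ {d} → position σ d < position σ b → E G d b → E G d c) → HasPan G ⊎ HasInduced G 4 DiamondAdj
  unresolved⇒panOrDiamond σ search {a} {b} {c} a<b b<c a~c ¬a~b resolved
    with walk⇒inducedPath (search (suc (position σ b)) b a ≤-refl (s≤s (<⇒≤ a<b)))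
  ... | path , (path₀ , path-end) , upToB =
    inducedPanOrDiamond path 2≤len c c∉path c~v₁ (subst (E G c) (≡-sym path-end) (sym G a~c))
    where
    2≤len = nonadjacentEnds⇒2≤len {path} (path₀ , path-end) (λ { refl → <-irrefl refl a<b }) (¬a~b ∘ sym G)
    c∉path : ∀ {i} → i ≤ len path → c ≢ vertex path i
    c∉path i≤ refl = <⇒≱ b<c (≤-pred (upToB i≤))
    v₁~b : E G (vertex path 1) b
    v₁~b = subst (E G _) path₀ (sym G (adjacent path (<-trans (s≤s z≤n) 2≤len)))
    v₁<b : position σ (vertex path 1) < position σ b
    v₁<b = ≤∧≢⇒< (≤-pred (upToB (<⇒≤ 2≤len)))
                 (λ eq → distinct path (s≤s z≤n) (<⇒≤ 2≤len) (≡-trans path₀ (≡-sym (position-injective σ eq))))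
    c~v₁ : E G c (vertex path 1)
    c~v₁ = sym G (resolved v₁<b v₁~b)

  searchOrdering⇒MNS : PanFree G → DiamondFree G → ∀ σ → GraphSearchOrdering G σ → MNSOrdering G σ
  searchOrdering⇒MNS panFree diamondFree σ search a b c a<b b<c a~c ¬a~b
    with Fin.any? (λ d → (σ ⟨$⟩ˡ d) Fin.<? (σ ⟨$⟩ˡ b) ×-dec dec G d b ×-dec ¬? (dec G d c))
  ... | yes privateNeighbour = privateNeighbour
  ... | no none = ⊥-elim ([ (λ (k , 3≤k , pan) → panFree k 3≤k pan) , diamondFree ]′
                             (unresolved⇒panOrDiamond σ search a<b b<c a~c ¬a~b resolved))
    where
    resolved : ∀ {d} → position σ d < position σ b → E G d b → E G d c
    resolved d<b d~b = decidable-stable (dec G _ c) (λ ¬d~c → none (_ , d<b , d~b , ¬d~c))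

  -- Extending a connected sequence to a search ordering

  record SearchSequence (p : ℕ) : Set where
    field
      label            : ℕ → Fin (n G)
      label-injective  : ∀ {i j} → i < p → j < p → label i ≡ label j → i ≡ j
      earlierNeighbour : ∀ {j} → 0 < j → j < p → ∃[ i ] i < j × E G (label i) (label j)

  open SearchSequence

  Extends : ∀ {q p} → SearchSequence q → SearchSequence p → Set
  Extends {p = p} s′ s = ∀ {j} → j < p → label s′ j ≡ label s j

  length≤ : ∀ {p} → SearchSequence p → p ≤ n G
  length≤ s = Fin.injective⇒≤ {f = λ i → label s (toℕ i)}
                (λ eq → Fin.toℕ-injective (label-injective s (Fin.toℕ<n _) (Fin.toℕ<n _) eq))

  Occurs : ∀ {p} → SearchSequence p → Fin (n G) → Set
  Occurs {p} s x = ∃[ i ] i < p × label s i ≡ x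

  occurs? : ∀ {p} (s : SearchSequence p) x → Dec (Occurs s x)
  occurs? {p} s x = anyUpTo? (λ i → label s i Fin.≟ x) p

  append : ∀ {p} (s : SearchSequence p) (x : Fin (n G)) → ¬ Occurs s x → (∃[ u ] Occurs s u × E G u x) →
           Σ (SearchSequence (suc p)) λ s′ → Extends s′ s
  append {p} s x fresh (u , (i , i<p , label≡u) , u~x) = s′ , label′-old
    where
    label′ : ℕ → Fin (n G)
    label′ j with j ≟ p
    ... | yes _ = x
    ... | no _ = label s j
    label′-new : label′ p ≡ x
    label′-new with p ≟ p
    ... | yes _ = refl
    ... | no p≢p = contradiction refl p≢p
    label′-old : ∀ {j} → j < p → label′ j ≡ label s j
    label′-old {j} j<p with j ≟ p
    ... | yes refl = contradiction j<p (<-irrefl refl)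
    ... | no _ = refl
    oldOrNew : ∀ {j} → j < suc p → j < p ⊎ j ≡ p
    oldOrNew j< = m≤n⇒m<n∨m≡n (≤-pred j<)
    new-fresh : ∀ {i} → i < p → label′ i ≢ label′ p
    new-fresh i<p eq = fresh (_ , i<p , ≡-trans (≡-sym (label′-old i<p)) (≡-trans eq label′-new))
    injective′ : ∀ {i j} → i < suc p → j < suc p → label′ i ≡ label′ j → i ≡ j
    injective′ i< j< eq with oldOrNew i< | oldOrNew j<
    ... | inj₁ i<p | inj₁ j<p =
      label-injective s i<p j<p (≡-trans (≡-sym (label′-old i<p)) (≡-trans eq (label′-old j<p)))
    ... | inj₁ i<p | inj₂ refl = contradiction eq (new-fresh i<p)
    ... | inj₂ refl | inj₁ j<p = contradiction (≡-sym eq) (new-fresh j<p)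
    ... | inj₂ refl | inj₂ refl = refl
    earlier′ : ∀ {j} → 0 < j → j < suc p → ∃[ i ] i < j × E G (label′ i) (label′ j)
    earlier′ 0<j j< with oldOrNew j<
    ... | inj₁ j<p =
      let h , h<j , h~j = earlierNeighbour s 0<j j<p
      in h , h<j , subst₂ (E G) (≡-sym (label′-old (<-trans h<j j<p))) (≡-sym (label′-old j<p)) h~j
    ... | inj₂ refl = i , i<p , subst₂ (E G) (≡-sym (≡-trans (label′-old i<p) label≡u)) (≡-sym label′-new) u~x
    s′ : SearchSequence (suc p)
    s′ = record { label = label′ ; label-injective = injective′ ; earlierNeighbour = earlier′ }

  extend : Connected G → ∀ {p} → 0 < p → p < n G → (s : SearchSequence p) →
           Σ (SearchSequence (suc p)) λ s′ → Extends s′ s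
  extend connected 0<p p<N s =
    let u , x , u-occurs , x-fresh , u~x = crossingEdge (occurs? s) (connected (label s 0) missed _ _)
                                                        (0 , 0<p , refl) ¬occurs-missed
    in append s x x-fresh (u , u-occurs , u~x)
    where
    missing = missedValue (λ i → label s (toℕ i)) p<N
    missed = proj₁ missing
    ¬occurs-missed : ¬ Occurs s missed
    ¬occurs-missed (i , i<p , label≡) =
      proj₂ missing (fromℕ< i<p , subst (λ j → label s j ≡ missed) (≡-sym (Fin.toℕ-fromℕ< i<p)) label≡)

  complete : Connected G → ∀ {p} → 0 < p → (s : SearchSequence p) → Σ (SearchSequence (n G)) λ s′ → Extends s′ s
  complete connected 0<p s = go _ (m+[n∸m]≡n (length≤ s)) 0<p s
    where
    go : ∀ f {p} → p + f ≡ n G → 0 < p → (s : SearchSequence p) → Σ (SearchSequence (n G)) λ s′ → Extends s′ s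
    go zero {p} p+0≡N _ s with ≡-trans (≡-sym (+-identityʳ p)) p+0≡N
    ... | refl = s , λ _ → refl
    go (suc f) {p} p+1+f≡N 0<p s =
      let s₁ , s₁-extends = extend connected 0<p p<N s
          s′ , s′-extends = go f (≡-trans (≡-sym (+-suc p f)) p+1+f≡N) (s≤s z≤n) s₁
      in s′ , λ j<p → ≡-trans (s′-extends (m<n⇒m<1+n j<p)) (s₁-extends j<p)
      where
      p<N : p < n G
      p<N = subst (p <_) p+1+f≡N (m<m+n p (s≤s z≤n))

  module _ (s : SearchSequence (n G)) where

    toOrdering : Ordering G
    toOrdering = injective⇒permutation (label s ∘ toℕ)
                   (λ eq → Fin.toℕ-injective (label-injective s (Fin.toℕ<n _) (Fin.toℕ<n _) eq))

    label-position : ∀ x → label s (position toOrdering x) ≡ x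
    label-position x = inverseʳ toOrdering

    position-label : ∀ {j} → j < n G → position toOrdering (label s j) ≡ j
    position-label {j} j<N = begin
      toℕ (toOrdering ⟨$⟩ˡ label s j)                          ≡⟨ cong (λ i → toℕ (toOrdering ⟨$⟩ˡ label s i)) (Fin.toℕ-fromℕ< j<N) ⟨
      toℕ (toOrdering ⟨$⟩ˡ (toOrdering ⟨$⟩ʳ fromℕ< j<N))       ≡⟨ cong toℕ (inverseˡ toOrdering) ⟩
      toℕ (fromℕ< j<N)                                        ≡⟨ Fin.toℕ-fromℕ< j<N ⟩
      j                                                       ∎
      where open ≡-Reasoning

    toOrdering-search : GraphSearchOrdering G toOrdering
    toOrdering-search k x y x<k y<k = walk-++ (fromVertex x x<k) (walk-reverse (fromVertex y y<k))
      where
      Prefix : Fin (n G) → Set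
      Prefix z = position toOrdering z < k
      toFirst : ∀ j → j < n G → j < k → WalkIn G Prefix (label s j) (label s 0)
      toFirst = <-rec _ λ where
        zero _ 0<N 0<k → here (subst (_< k) (≡-sym (position-label 0<N)) 0<k)
        (suc j) toFirst′ j<N j<k →
          let i , i<j , i~j = earlierNeighbour s (s≤s z≤n) j<N
          in step (subst (_< k) (≡-sym (position-label j<N)) j<k) (sym G i~j)
                  (toFirst′ i<j (<-trans i<j j<N) (<-trans i<j j<k))
      fromVertex : ∀ z → Prefix z → WalkIn G Prefix z (label s 0)
      fromVertex z z<k = subst (λ v → WalkIn G Prefix v (label s 0)) (label-position z)
                               (toFirst _ (Fin.toℕ<n _) z<k)

  record MNSViolation {p} (s : SearchSequence p) : Set where
    field
      a b c      : ℕ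
      a<b        : a < b
      b<c        : b < c
      c<p        : c < p
      a~c        : E G (label s a) (label s c)
      ¬a~b       : ¬ E G (label s a) (label s b)
      unresolved : ∀ {d} → d < b → E G (label s d) (label s b) → E G (label s d) (label s c)

  violation-extends : ∀ {p} {s : SearchSequence p} {s′ : SearchSequence (n G)} → Extends s′ s →
                      MNSViolation s → MNSViolation s′
  violation-extends {s = s} s′-extends v = record
    { a = a ; b = b ; c = c ; a<b = a<b ; b<c = b<c ; c<p = <-≤-trans c<p (length≤ s)
    ; a~c = subst₂ (E G) (≡-sym (s′-extends a<p)) (≡-sym (s′-extends c<p)) a~c
    ; ¬a~b = ¬a~b ∘ subst₂ (E G) (s′-extends a<p) (s′-extends b<p)
    ; unresolved = λ d<b d~b → subst₂ (E G) (≡-sym (s′-extends (<-trans d<b b<p))) (≡-sym (s′-extends c<p))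
                     (unresolved d<b (subst₂ (E G) (s′-extends (<-trans d<b b<p)) (s′-extends b<p) d~b)) }
    where
    open MNSViolation v
    b<p = <-trans b<c c<p
    a<p = <-trans a<b b<p

  violation⇒¬MNS : (s : SearchSequence (n G)) → MNSViolation s → ¬ MNSOrdering G (toOrdering s)
  violation⇒¬MNS s v mns =
    let d , d<b , d~b , ¬d~c = mns (label s a) (label s b) (label s c) (inOrder a<b b<N) (inOrder b<c c<p) a~c ¬a~b
    in ¬d~c (subst (λ x → E G x (label s c)) (label-position s d)
               (unresolved (subst (position (toOrdering s) d <_) (position-label s b<N) d<b)
                           (subst (λ x → E G x (label s b)) (≡-sym (label-position s d)) d~b)))
    where
    open MNSViolation v
    b<N = <-trans b<c c<p
    inOrder : ∀ {i j} → i < j → j < n G →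
              position (toOrdering s) (label s i) < position (toOrdering s) (label s j)
    inOrder i<j j<N = subst₂ _<_ (≡-sym (position-label s (<-trans i<j j<N))) (≡-sym (position-label s j<N)) i<j

  violation⇒nonMNSSearchOrdering : Connected G → ∀ {p} (s : SearchSequence p) → MNSViolation s →
                                   NonMNSSearchOrdering G
  violation⇒nonMNSSearchOrdering connected s v =
    toOrdering s′ , toOrdering-search s′ , violation⇒¬MNS s′ (violation-extends s′-extends v)
    where
    open MNSViolation v
    completion = complete connected (≤-<-trans z≤n (<-trans a<b (<-trans b<c c<p))) s
    s′ = proj₁ completion
    s′-extends = proj₂ completion

  -- Pans and diamonds have search orderings that are not MNS orderings

  InducedUpTo : ℕ → (ℕ → ℕ → Set) → Set
  InducedUpTo k R = Σ (ℕ → Fin (n G)) λ F →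
    (∀ {i j} → i ≤ k → j ≤ k → F i ≡ F j → i ≡ j) × (∀ {i j} → i ≤ k → j ≤ k → E G (F i) (F j) ⇔ R i j)

  inducedUpTo : ∀ {k R} → HasInduced G (suc k) (λ i j → R (toℕ i) (toℕ j)) → InducedUpTo k R
  inducedUpTo {k} {R} (f , f-injective , f-adjacent) = f ∘ clamp k , injective , adjacency
    where
    injective : ∀ {i j} → i ≤ k → j ≤ k → f (clamp k i) ≡ f (clamp k j) → i ≡ j
    injective i≤k j≤k eq = ≡-trans (≡-sym (toℕ-clamp i≤k)) (≡-trans (cong toℕ (f-injective eq)) (toℕ-clamp j≤k))
    adjacency : ∀ {i j} → i ≤ k → j ≤ k → E G (f (clamp k i)) (f (clamp k j)) ⇔ R i j
    adjacency {i} {j} i≤k j≤k = subst₂ (λ i′ j′ → E G (f (clamp k i)) (f (clamp k j)) ⇔ R i′ j′) (toℕ-clamp i≤k) (toℕ-clamp j≤k)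
                                      (f-adjacent (clamp k i) (clamp k j))

  -- The pattern is visited in the order 0, …, k − 1, suc k, k, and (a, suc k, k) violates MNS.
  swapLastViolation : ∀ {k R} → InducedUpTo (suc k) R →
    (∀ {v} → 0 < v → v < k → ∃[ u ] u < v × R u v) → (∃[ u ] u < k × R u (suc k)) →
    ∀ {a} → a < k → R a k → ¬ R a (suc k) → (∀ {u} → u < k → R u (suc k) → R u k) →
    Σ (SearchSequence (2 + k)) MNSViolation
  swapLastViolation {k} {R} (F , F-injective , F-adjacent) earlier reachesSuc {a} a<k a~k ¬a~sk resolved =
    s , record { a = a ; b = k ; c = suc k ; a<b = a<k ; b<c = ≤-refl ; c<p = ≤-refl
               ; a~c = edgeAt (below a<k) (n≤1+n k) (swapSuc-< a<k) (swapSuc-suc k) a~k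
               ; ¬a~b = ¬a~sk ∘ relationAt (below a<k) ≤-refl (swapSuc-< a<k) (swapSuc-self k)
               ; unresolved = λ d<k → edgeAt (below d<k) (n≤1+n k) (swapSuc-< d<k) (swapSuc-suc k)
                                      ∘ resolved d<k ∘ relationAt (below d<k) ≤-refl (swapSuc-< d<k) (swapSuc-self k) }
    where
    swapped : ℕ → Fin (n G)
    swapped j = F (swapSuc k j)
    below : ∀ {i} → i < k → i ≤ suc k
    below i<k = m≤n⇒m≤1+n (<⇒≤ i<k)
    edgeAt : ∀ {i j i′ j′} → i′ ≤ suc k → j′ ≤ suc k → swapSuc k i ≡ i′ → swapSuc k j ≡ j′ →
             R i′ j′ → E G (swapped i) (swapped j)
    edgeAt i′≤ j′≤ refl refl = Equivalence.from (F-adjacent i′≤ j′≤)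
    relationAt : ∀ {i j i′ j′} → i′ ≤ suc k → j′ ≤ suc k → swapSuc k i ≡ i′ → swapSuc k j ≡ j′ →
                 E G (swapped i) (swapped j) → R i′ j′
    relationAt i′≤ j′≤ refl refl = Equivalence.to (F-adjacent i′≤ j′≤)
    injective : ∀ {i j} → i < 2 + k → j < 2 + k → swapped i ≡ swapped j → i ≡ j
    injective {i} {j} i< j< eq = begin
      i                         ≡⟨ swapSuc-involutive k i ⟨
      swapSuc k (swapSuc k i)   ≡⟨ cong (swapSuc k) (F-injective (swapSuc-≤ (≤-pred i<)) (swapSuc-≤ (≤-pred j<)) eq) ⟩
      swapSuc k (swapSuc k j)   ≡⟨ swapSuc-involutive k j ⟩
      j                         ∎
      where open ≡-Reasoning
    earlier′ : ∀ {j} → 0 < j → j < 2 + k → ∃[ i ] i < j × E G (swapped i) (swapped j)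
    earlier′ {j} 0<j j< with <-cmp j k
    ... | tri< j<k _ _ =
      let u , u<j , u~j = earlier 0<j j<k
          u<k = <-trans u<j j<k
      in u , u<j , edgeAt (below u<k) (below j<k) (swapSuc-< u<k) (swapSuc-< j<k) u~j
    ... | tri≈ _ refl _ =
      let u , u<k , u~sk = reachesSuc
      in u , u<k , edgeAt (below u<k) ≤-refl (swapSuc-< u<k) (swapSuc-self k) u~sk
    ... | tri> _ _ k<j with ≤-antisym (≤-pred j<) k<j
    ...   | refl = a , m<n⇒m<1+n a<k , edgeAt (below a<k) (n≤1+n k) (swapSuc-< a<k) (swapSuc-suc k) a~k
    s : SearchSequence (2 + k)
    s = record { label = swapped ; label-injective = injective ; earlierNeighbour = earlier′ }

  diamond⇒nonMNSSearchOrdering : Connected G → HasInduced G 4 DiamondAdj → NonMNSSearchOrdering G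
  diamond⇒nonMNSSearchOrdering connected diamond =
    uncurry (violation⇒nonMNSSearchOrdering connected)
      (swapLastViolation {k = 2} (inducedUpTo diamond) earlier (1 , ≤-refl , diamondEdge 1 3)
                         {a = 0} (s≤s z≤n) (diamondEdge 0 2) ¬diamondEdge₀₃ resolved)
    where
    diamondEdge : ∀ a b → {True (diamondAdj? a b)} → DiamondAdjℕ a b
    diamondEdge a b {t} = toWitness t
    ¬diamondEdge₀₃ : ¬ DiamondAdjℕ 0 3
    ¬diamondEdge₀₃ = toWitnessFalse {a? = diamondAdj? 0 3} _
    earlier : ∀ {v} → 0 < v → v < 2 → ∃[ u ] u < v × DiamondAdjℕ u v
    earlier {suc zero} _ _ = 0 , ≤-refl , diamondEdge 0 1
    earlier {suc (suc _)} _ (s≤s (s≤s ()))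
    resolved : ∀ {u} → u < 2 → DiamondAdjℕ u 3 → DiamondAdjℕ u 2
    resolved {zero} _ d = contradiction d ¬diamondEdge₀₃
    resolved {suc zero} _ _ = diamondEdge 1 2
    resolved {suc (suc _)} (s≤s (s≤s ()))

  pan⇒nonMNSSearchOrdering : Connected G → ∀ {m} → 1 ≤ m → HasInduced G (3 + m) (PanAdj (2 + m)) →
                             NonMNSSearchOrdering G
  pan⇒nonMNSSearchOrdering connected {m} 1≤m pan =
    uncurry (violation⇒nonMNSSearchOrdering connected)
      (swapLastViolation {k = suc m} (inducedUpTo pan) earlier (0 , s≤s z≤n , pendantEdge z≤n refl)
                         {a = m} ≤-refl (closingEdge ≤-refl (inj₂ refl)) ¬pendantEdge resolved)
    where
    open Equivalence
    pendantEdge : ∀ {u} → u ≤ m → u ≡ 0 → PanAdjℕ (2 + m) u (2 + m)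
    pendantEdge u≤m = from (panAdj-pendant u≤m)
    closingEdge : ∀ {u} → u ≤ m → u ≡ 0 ⊎ u ≡ m → PanAdjℕ (2 + m) u (suc m)
    closingEdge u≤m = from (panAdj-closing u≤m)
    ¬pendantEdge : ¬ PanAdjℕ (2 + m) m (2 + m)
    ¬pendantEdge e = <⇒≢ 1≤m (≡-sym (to (panAdj-pendant ≤-refl) e))
    earlier : ∀ {v} → 0 < v → v < suc m → ∃[ u ] u < v × PanAdjℕ (2 + m) u v
    earlier {suc u} _ (s≤s 1+u≤m) = u , ≤-refl , from (panAdj-cycle (<⇒≤ 1+u≤m) 1+u≤m) (inj₁ refl)
    resolved : ∀ {u} → u < suc m → PanAdjℕ (2 + m) u (2 + m) → PanAdjℕ (2 + m) u (suc m)
    resolved (s≤s u≤m) e = closingEdge u≤m (inj₁ (to (panAdj-pendant u≤m) e))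

corollary4 : (G : Graph) → Connected G →
    ((∀ (σ : Ordering G) → GraphSearchOrdering G σ → MNSOrdering G σ) ⇔ (PanFree G × DiamondFree G))
corollary4 G connected = mk⇔
  (λ allMNS → (λ { (suc (suc (suc _))) (s≤s (s≤s (s≤s _))) pan →
                     refute allMNS (pan⇒nonMNSSearchOrdering connected (s≤s z≤n) pan) })
            , refute allMNS ∘ diamond⇒nonMNSSearchOrdering connected)
  (λ (panFree , diamondFree) → searchOrdering⇒MNS {G = G} panFree diamondFree)
  where
  refute : (∀ σ → GraphSearchOrdering G σ → MNSOrdering G σ) → ¬ NonMNSSearchOrdering G
  refute allMNS (σ , search , ¬mns) = ¬mns (allMNS σ search)
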